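{- Let $n\ge 2$ and $k$ be integers. Suppose we are given a corner solution modeled after a variety $v$, together with $k(n-2)$ colored cubes each of which shares exactly $k$ adjacent pairs with $v$. Then all $k(n-2)$ of these cubes can be placed into (distinct) non-corner positions of the frame of an $n\times n\times n$ cube whose corners are the given corner solution, with every outer face of the big cube remaining monochromatic.
   Context: Fix a palette of six colors. A colored cube is a unit cube each face painted one color, all six colors appearing. Varieties are colored cubes up to rigid rotation. An adjacent pair of a cube is the unordered pair of colors on two faces sharing an edge (each cube has $12$). A corner solution is a set of eight cubes arranged as a $2\times2\times2$ cube (or as the eight corners of a larger cube) with each outer face monochromatic; it is modeled after variety $v$ if the resulting big cube has the coloring of $v$. The frame of an $n\times n\times n$ cube consists of its $12n-16$ edge positions (corners included); the $n-2$ non-corner positions on an edge of the big cube corresponding to an edge of $v$ with adjacent pair $\{x,y\}$ must be filled by cubes showing colors $x$ and $y$ on the two exposed faces. -}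

module Defs where

open import Data.Nat using (ℕ; zero; suc; _+_; _*_; _∸_; _≤_; _<ᵇ_)
open import Data.Nat.Properties using (_≟_)
open import Data.Bool using (Bool; true; false; _∧_; not; if_then_else_)
open import Data.Fin using (Fin; toℕ) renaming (zero to f0; suc to fs)
import Data.Fin.Properties as FinP
open import Data.List using (List; allFin; map)
open import Data.Nat.ListAction using (sum)
open import Data.Bool.ListAction using (any)
open import Data.Product using (Σ; ∃; _×_; _,_)
open import Relation.Nullary.Decidable using (⌊_⌋)
open import Relation.Binary.PropositionalEquality using (_≡_; _≢_)

Color : Set
Color = Fin 6

-- The six faces of a (unit or big) cube, in a fixed coordinate frame:
-- 0 = +x, 1 = -x, 2 = +y, 3 = -y, 4 = +z, 5 = -z.
Face : Set
Face = Fin 6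

pattern F0 = f0
pattern F1 = fs f0
pattern F2 = fs (fs f0)
pattern F3 = fs (fs (fs f0))
pattern F4 = fs (fs (fs (fs f0)))
pattern F5 = fs (fs (fs (fs (fs f0))))

opp : Face → Face
opp F0 = F1
opp F1 = F0
opp F2 = F3
opp F3 = F2
opp F4 = F5
opp F5 = F4

axis : Face → Fin 3
axis F0 = f0
axis F1 = f0
axis F2 = fs f0
axis F3 = fs f0
axis F4 = fs (fs f0)
axis F5 = fs (fs f0)

positive : Face → Bool
positive F0 = true
positive F1 = false
positive F2 = true
positive F3 = false
positive F4 = true
positive F5 = false

faceAdjB : Face → Face → Bool
faceAdjB f g = not ⌊ f FinP.≟ g ⌋ ∧ not ⌊ g FinP.≟ opp f ⌋

record Cube : Set where
  field
    col : Face → Color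
    allColors : ∀ (c : Color) → ∃ λ (f : Face) → col f ≡ c
open Cube public

-- Rigid rotations, as words in two generating quarter turns.

σx : Face → Face
σx F0 = F0
σx F1 = F1
σx F2 = F4
σx F4 = F3
σx F3 = F5
σx F5 = F2

σz : Face → Face
σz F0 = F2
σz F2 = F1
σz F1 = F3
σz F3 = F0
σz F4 = F4
σz F5 = F5

data Rot : Set where
  idR  : Rot
  _·x  : Rot → Rot
  _·z  : Rot → Rot

⟦_⟧ : Rot → Face → Face
⟦ idR ⟧ f = f
⟦ r ·x ⟧ f = ⟦ r ⟧ (σx f)
⟦ r ·z ⟧ f = ⟦ r ⟧ (σz f)

-- The cube c, rotated by ρ, shows on face f the color col c (⟦ ρ ⟧ f).
-- Two cubes are of the same variety iff they agree after some rotation.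
SameVariety : Cube → Cube → Set
SameVariety w v = Σ Rot λ ρ → ∀ (f : Face) → col w f ≡ col v (⟦ ρ ⟧ f)

adjPairB : Cube → Color → Color → Bool
adjPairB c a b =
  any (λ f → any (λ g → faceAdjB f g
                        ∧ ⌊ col c f FinP.≟ a ⌋ ∧ ⌊ col c g FinP.≟ b ⌋)
                 (allFin 6))
      (allFin 6)

-- Number of (unordered) adjacent pairs shared by c and v;
-- each unordered pair {a,b} is counted once, as (a,b) with a < b.
sharedPairs : Cube → Cube → ℕ
sharedPairs c v =
  sum (map (λ a → sum (map (λ b →
        if (toℕ a <ᵇ toℕ b) ∧ adjPairB c a b ∧ adjPairB v a b then 1 else 0)
        (allFin 6))) (allFin 6))

Pos : ℕ → Set
Pos n = Fin n × Fin n × Fin n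

coord : {n : ℕ} → Fin 3 → Pos n → Fin n
coord f0 (i , j , l) = i
coord (fs f0) (i , j , l) = j
coord (fs (fs f0)) (i , j , l) = l

onFaceB : {n : ℕ} → Pos n → Face → Bool
onFaceB {n} p f =
  ⌊ toℕ (coord (axis f) p) ≟ (if positive f then n ∸ 1 else 0) ⌋

OnFace : {n : ℕ} → Pos n → Face → Set
OnFace p f = onFaceB p f ≡ true

numFaces : {n : ℕ} → Pos n → ℕ
numFaces p = sum (map (λ f → if onFaceB p f then 1 else 0) (allFin 6))

IsCorner : {n : ℕ} → Pos n → Set
IsCorner p = numFaces p ≡ 3

IsEdgeNonCorner : {n : ℕ} → Pos n → Set
IsEdgeNonCorner p = numFaces p ≡ 2

-- Cube c placed at p in orientation ρ keeps the outer faces of the big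
-- cube colored as w: each exposed face f of it shows the color col w f.
Fits : {n : ℕ} → Cube → Pos n → Cube → Rot → Set
Fits w p c ρ = ∀ (f : Face) → OnFace p f → col c (⟦ ρ ⟧ f) ≡ col w f

CornerSolution : (n : ℕ) → Cube → Set
CornerSolution n w =
  (p : Pos n) → IsCorner p → Σ Cube λ c → Σ Rot λ ρ → Fits w p c ρ

-- Write n = 2 + N.  An adjacent pair {a,b} of the big coloring w (the same
-- as those of v, since w and v are one variety) names the edge of the big
-- cube between the faces of w colored a and b; it has N non-corner slots.
-- A cube having {a,b} as an adjacent pair can be rotated to show a and b
-- outwards at any such slot, agreeing with w on all its exposed faces.
-- Split the k·N cubes into N layers of k.  Each cube has k shared pairs,
-- so a greedy system of distinct representatives gives the cubes of one
-- layer distinct pairs; cube i goes to slot t (its layer) of its pair's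
-- edge.  A slot determines its pair and layer, so positions are distinct.

module Submission where

open import Defs
open import Data.Nat using (ℕ; zero; suc; _+_; _*_; _∸_; _≤_; _<_; s≤s; z≤n; _<ᵇ_)
import Data.Nat as ℕ
import Data.Nat.Properties as ℕP
open import Data.Bool using (Bool; true; false; if_then_else_; _∧_; T)
open import Data.Unit using (tt)
import Data.Bool.Properties as BoolP
open import Data.Fin using (Fin; toℕ; fromℕ; inject₁; combine; remQuot)
  renaming (zero to f0; suc to fs)
import Data.Fin.Properties as FinP
open import Data.List using (List; _∷_; []; map; _++_; allFin; cartesianProduct)
open import Data.Nat.ListAction using (sum)
open import Data.Nat.ListAction.Properties using (sum-++)
open import Data.Bool.ListAction using (any)
import Data.List.Properties as ListP
open import Data.List.Membership.Propositional using (_∈_)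
open import Data.List.Relation.Unary.Any as Any using (Any; here; there)
import Data.List.Relation.Unary.Any.Properties as AnyP
import Data.List.Relation.Unary.All as All
open import Data.List.Relation.Unary.AllPairs using (_∷_)
open import Data.List.Relation.Unary.Unique.Propositional using (Unique)
import Data.List.Relation.Unary.Unique.Propositional.Properties as UniqueP
open import Data.Product using (Σ; ∃; _×_; _,_; proj₁; proj₂; uncurry)
import Data.Product.Properties as ProdP
open import Data.Sum using (_⊎_; inj₁; inj₂)
open import Data.Empty using (⊥; ⊥-elim)
open import Function using (_∘_; Equivalence)
open import Relation.Nullary using (yes; no; ¬_; ¬?)
open import Relation.Nullary.Decidable
  using (⌊_⌋; toWitness; _→-dec_; _⊎-dec_; _×-dec_)
open import Relation.Binary.Definitions using (DecidableEquality)
open import Relation.Binary.PropositionalEquality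

Adjacent : Face → Face → Set
Adjacent F G = faceAdjB F G ≡ true

rotations : List Rot
rotations = idR ∷ (idR ·x) ∷ (idR ·z) ∷ ((idR ·x) ·x) ∷ ((idR ·x) ·z)
  ∷ ((idR ·z) ·x) ∷ ((idR ·z) ·z) ∷ (((idR ·x) ·x) ·x) ∷ (((idR ·x) ·x) ·z)
  ∷ (((idR ·x) ·z) ·x) ∷ (((idR ·x) ·z) ·z) ∷ (((idR ·z) ·x) ·x)
  ∷ (((idR ·z) ·z) ·x) ∷ (((idR ·z) ·z) ·z) ∷ ((((idR ·x) ·x) ·x) ·z)
  ∷ ((((idR ·x) ·x) ·z) ·x) ∷ ((((idR ·x) ·x) ·z) ·z) ∷ ((((idR ·x) ·z) ·x) ·x)
  ∷ ((((idR ·x) ·z) ·z) ·z) ∷ ((((idR ·z) ·x) ·x) ·x) ∷ ((((idR ·z) ·z) ·z) ·x)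
  ∷ (((((idR ·x) ·x) ·x) ·z) ·x) ∷ (((((idR ·x) ·z) ·x) ·x) ·x)
  ∷ (((((idR ·x) ·z) ·z) ·z) ·x) ∷ []

-- Position of a unit cube along one axis of the big cube: on the low
-- outer face, on the high outer face, or strictly in between.
data Level : Set where
  low high mid : Level

_≟L_ : DecidableEquality Level
low  ≟L low  = yes refl
low  ≟L high = no λ ()
low  ≟L mid  = no λ ()
high ≟L low  = no λ ()
high ≟L high = yes refl
high ≟L mid  = no λ ()
mid  ≟L low  = no λ ()
mid  ≟L high = no λ ()
mid  ≟L mid  = yes refl

sideLevel : Face → Level
sideLevel f = if positive f then high else low

-- The edge of the big cube between the outer faces F and G, described by
-- its level along each axis: that of F or G on their axes, mid otherwise.
edgeLevel : Face → Face → Fin 3 → Level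
edgeLevel F G ax =
  if ⌊ axis F FinP.≟ ax ⌋ then sideLevel F
  else if ⌊ axis G FinP.≟ ax ⌋ then sideLevel G else mid

onEdgeB : Face → Face → Face → Bool
onEdgeB F G f = ⌊ edgeLevel F G (axis f) ≟L sideLevel f ⌋

opaque
  σx-adjacent : ∀ f g → faceAdjB (σx f) (σx g) ≡ faceAdjB f g
  σx-adjacent = toWitness {a? = FinP.all? λ f → FinP.all? λ g →
    faceAdjB (σx f) (σx g) BoolP.≟ faceAdjB f g} _

  σz-adjacent : ∀ f g → faceAdjB (σz f) (σz g) ≡ faceAdjB f g
  σz-adjacent = toWitness {a? = FinP.all? λ f → FinP.all? λ g →
    faceAdjB (σz f) (σz g) BoolP.≟ faceAdjB f g} _

  rotation-between : ∀ F G f g → Adjacent F G → Adjacent f g →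
    Any (λ τ → ⟦ τ ⟧ F ≡ f × ⟦ τ ⟧ G ≡ g) rotations
  rotation-between = toWitness {a? = FinP.all? λ F → FinP.all? λ G →
    FinP.all? λ f → FinP.all? λ g →
    (faceAdjB F G BoolP.≟ true) →-dec (faceAdjB f g BoolP.≟ true) →-dec
    Any.any? (λ τ → (⟦ τ ⟧ F FinP.≟ f) ×-dec (⟦ τ ⟧ G FinP.≟ g)) rotations} _

  edge-faces : ∀ F G f → Adjacent F G → onEdgeB F G f ≡ true → f ≡ F ⊎ f ≡ G
  edge-faces = toWitness {a? = FinP.all? λ F → FinP.all? λ G → FinP.all? λ f →
    (faceAdjB F G BoolP.≟ true) →-dec (onEdgeB F G f BoolP.≟ true) →-dec
    ((f FinP.≟ F) ⊎-dec (f FinP.≟ G))} _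

  edge-faceCount : ∀ F G → Adjacent F G →
    sum (map (λ f → if onEdgeB F G f then 1 else 0) (allFin 6)) ≡ 2
  edge-faceCount = toWitness {a? = FinP.all? λ F → FinP.all? λ G →
    (faceAdjB F G BoolP.≟ true) →-dec
    (sum (map (λ f → if onEdgeB F G f then 1 else 0) (allFin 6)) ℕ.≟ 2)} _

  edgeLevel-injective : ∀ F G F' G' → Adjacent F G → Adjacent F' G' →
    (∀ ax → edgeLevel F G ax ≡ edgeLevel F' G' ax) →
    (F ≡ F' × G ≡ G') ⊎ (F ≡ G' × G ≡ F')
  edgeLevel-injective F G F' G' a a' same = decided F G F' G' a a'
    (same f0) (same (fs f0)) (same (fs (fs f0)))
    where
    decided : ∀ F G F' G' → Adjacent F G → Adjacent F' G' →
      edgeLevel F G f0 ≡ edgeLevel F' G' f0 →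
      edgeLevel F G (fs f0) ≡ edgeLevel F' G' (fs f0) →
      edgeLevel F G (fs (fs f0)) ≡ edgeLevel F' G' (fs (fs f0)) →
      (F ≡ F' × G ≡ G') ⊎ (F ≡ G' × G ≡ F')
    decided = toWitness {a? = FinP.all? λ F → FinP.all? λ G →
      FinP.all? λ F' → FinP.all? λ G' →
      (faceAdjB F G BoolP.≟ true) →-dec (faceAdjB F' G' BoolP.≟ true) →-dec
      (edgeLevel F G f0 ≟L edgeLevel F' G' f0) →-dec
      (edgeLevel F G (fs f0) ≟L edgeLevel F' G' (fs f0)) →-dec
      (edgeLevel F G (fs (fs f0)) ≟L edgeLevel F' G' (fs (fs f0))) →-dec
      (((F FinP.≟ F') ×-dec (G FinP.≟ G')) ⊎-dec ((F FinP.≟ G') ×-dec (G FinP.≟ F')))} _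

  edge-direction : ∀ F G → Adjacent F G → ∃ λ ax → edgeLevel F G ax ≡ mid
  edge-direction = toWitness {a? = FinP.all? λ F → FinP.all? λ G →
    (faceAdjB F G BoolP.≟ true) →-dec FinP.any? (λ ax → edgeLevel F G ax ≟L mid)} _

rotate-adjacent : ∀ ρ f g → faceAdjB (⟦ ρ ⟧ f) (⟦ ρ ⟧ g) ≡ faceAdjB f g
rotate-adjacent idR f g = refl
rotate-adjacent (ρ ·x) f g = trans (rotate-adjacent ρ (σx f) (σx g)) (σx-adjacent f g)
rotate-adjacent (ρ ·z) f g = trans (rotate-adjacent ρ (σz f) (σz g)) (σz-adjacent f g)

σx-onto : ∀ f → ∃ λ f' → σx f' ≡ f
σx-onto F0 = F0 , refl
σx-onto F1 = F1 , refl
σx-onto F2 = F5 , refl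
σx-onto F3 = F4 , refl
σx-onto F4 = F2 , refl
σx-onto F5 = F3 , refl

σz-onto : ∀ f → ∃ λ f' → σz f' ≡ f
σz-onto F0 = F3 , refl
σz-onto F1 = F2 , refl
σz-onto F2 = F0 , refl
σz-onto F3 = F1 , refl
σz-onto F4 = F4 , refl
σz-onto F5 = F5 , refl

rotate-onto : ∀ ρ f → ∃ λ f' → ⟦ ρ ⟧ f' ≡ f
rotate-onto idR f = f , refl
rotate-onto (ρ ·x) f
  with f₁ , ρf₁≡f ← rotate-onto ρ f
  with f₂ , σf₂≡f₁ ← σx-onto f₁
  = f₂ , trans (cong ⟦ ρ ⟧ σf₂≡f₁) ρf₁≡f
rotate-onto (ρ ·z) f
  with f₁ , ρf₁≡f ← rotate-onto ρ f
  with f₂ , σf₂≡f₁ ← σz-onto f₁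
  = f₂ , trans (cong ⟦ ρ ⟧ σf₂≡f₁) ρf₁≡f

record AdjacentFaces (c : Cube) (a b : Color) : Set where
  constructor adjacentFaces
  field
    faceA faceB : Face
    adjacent    : Adjacent faceA faceB
    colorA      : col c faceA ≡ a
    colorB      : col c faceB ≡ b

adjacentColoredB : Cube → Color → Color → Face → Face → Bool
adjacentColoredB c a b f g = faceAdjB f g ∧ ⌊ col c f FinP.≟ a ⌋ ∧ ⌊ col c g FinP.≟ b ⌋

adjacentFaces-of : ∀ c a b → T (adjPairB c a b) → AdjacentFaces c a b
adjacentFaces-of c a b holds
  with f , row ← Any.satisfied
                  (AnyP.any⁻ (λ f → any (adjacentColoredB c a b f) (allFin 6)) (allFin 6) holds)
  with g , fg  ← Any.satisfied (AnyP.any⁻ (adjacentColoredB c a b f) (allFin 6) row)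
  with adj , colors ← Equivalence.to (BoolP.T-∧ {faceAdjB f g}) fg
  with ca , cb      ← Equivalence.to (BoolP.T-∧ {⌊ col c f FinP.≟ a ⌋}) colors
  = adjacentFaces f g (Equivalence.to BoolP.T-≡ adj) (toWitness ca) (toWitness cb)

transport-adjacentFaces : ∀ {v w a b} → SameVariety w v →
  AdjacentFaces v a b → AdjacentFaces w a b
transport-adjacentFaces {v} (ρ , w≡vρ) (adjacentFaces f g adj ca cb)
  with f' , ρf'≡f ← rotate-onto ρ f
  with g' , ρg'≡g ← rotate-onto ρ g
  = adjacentFaces f' g'
      (trans (sym (rotate-adjacent ρ f' g'))
             (subst₂ (λ x y → faceAdjB x y ≡ true) (sym ρf'≡f) (sym ρg'≡g) adj))
      (trans (w≡vρ f') (trans (cong (col v) ρf'≡f) ca))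
      (trans (w≡vρ g') (trans (cong (col v) ρg'≡g) cb))

alignment : ∀ {w c a b} (W : AdjacentFaces w a b) (C : AdjacentFaces c a b) →
  ∃ λ τ → ⟦ τ ⟧ (AdjacentFaces.faceA W) ≡ AdjacentFaces.faceA C
        × ⟦ τ ⟧ (AdjacentFaces.faceB W) ≡ AdjacentFaces.faceB C
alignment (adjacentFaces F G adj _ _) (adjacentFaces f g adj' _ _) =
  Any.satisfied (rotation-between F G f g adj adj')

alignment-fits : ∀ {n w c a b} (W : AdjacentFaces w a b) (C : AdjacentFaces c a b)
  (p : Pos n) → (∀ f → OnFace p f → f ≡ AdjacentFaces.faceA W ⊎ f ≡ AdjacentFaces.faceB W) →
  Fits w p c (proj₁ (alignment W C))
alignment-fits {c = c} W@(adjacentFaces _ _ _ wa wb) C@(adjacentFaces _ _ _ ca cb) p exposed f onF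
  with τF≡fc , τG≡gc ← proj₂ (alignment W C)
  with exposed f onF
... | inj₁ refl = trans (cong (col c) τF≡fc) (trans ca (sym wa))
... | inj₂ refl = trans (cong (col c) τG≡gc) (trans cb (sym wb))

-- Coordinate, along one axis of the n×n×n cube with n = 2 + N, of the
-- unit cube at a given level; slot t of an edge has coordinate 1 + t
-- along the edge's direction.
levelCoord : {N : ℕ} → Level → Fin N → Fin (suc (suc N))
levelCoord     low  t = f0
levelCoord {N} high t = fromℕ (suc N)
levelCoord     mid  t = fs (inject₁ t)

edgeSlot : {N : ℕ} → Face → Face → Fin N → Pos (suc (suc N))
edgeSlot F G t =
  levelCoord (edgeLevel F G f0) t , levelCoord (edgeLevel F G (fs f0)) t ,
  levelCoord (edgeLevel F G (fs (fs f0))) t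

coord-edgeSlot : ∀ {N} F G (t : Fin N) ax →
  coord ax (edgeSlot F G t) ≡ levelCoord (edgeLevel F G ax) t
coord-edgeSlot F G t f0           = refl
coord-edgeSlot F G t (fs f0)      = refl
coord-edgeSlot F G t (fs (fs f0)) = refl

levelCoord-onSide : ∀ {N} κ (t : Fin N) (s : Bool) →
  ⌊ toℕ (levelCoord κ t) ℕ.≟ (if s then suc N else 0) ⌋ ≡ ⌊ κ ≟L (if s then high else low) ⌋
levelCoord-onSide low  t false = refl
levelCoord-onSide high t false = refl
levelCoord-onSide mid  t false = refl
levelCoord-onSide low  t true  = refl
levelCoord-onSide {N} high t true with toℕ (fromℕ (suc N)) ℕ.≟ suc N
... | yes _    = refl
... | no  ≢top = ⊥-elim (≢top (FinP.toℕ-fromℕ (suc N)))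
levelCoord-onSide {N} mid  t true with suc (toℕ (inject₁ t)) ℕ.≟ suc N
... | yes top = ⊥-elim (FinP.toℕ-inject₁-≢ t (sym (ℕP.suc-injective top)))
... | no  _   = refl

onFace-edgeSlot : ∀ {N} F G (t : Fin N) f → onFaceB (edgeSlot F G t) f ≡ onEdgeB F G f
onFace-edgeSlot {N} F G t f = begin
  ⌊ toℕ (coord (axis f) (edgeSlot F G t)) ℕ.≟ (if positive f then suc N else 0) ⌋
    ≡⟨ cong (λ x → ⌊ toℕ x ℕ.≟ (if positive f then suc N else 0) ⌋) (coord-edgeSlot F G t (axis f)) ⟩
  ⌊ toℕ (levelCoord (edgeLevel F G (axis f)) t) ℕ.≟ (if positive f then suc N else 0) ⌋
    ≡⟨ levelCoord-onSide (edgeLevel F G (axis f)) t (positive f) ⟩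
  onEdgeB F G f ∎
  where open ≡-Reasoning

edgeSlot-isEdge : ∀ {N} F G (t : Fin N) → Adjacent F G → IsEdgeNonCorner (edgeSlot F G t)
edgeSlot-isEdge F G t adj =
  trans (cong sum (ListP.map-cong (λ f → cong (λ b → if b then 1 else 0) (onFace-edgeSlot F G t f)) (allFin 6)))
        (edge-faceCount F G adj)

edgeSlot-exposes : ∀ {N} F G (t : Fin N) → Adjacent F G →
  ∀ f → OnFace (edgeSlot F G t) f → f ≡ F ⊎ f ≡ G
edgeSlot-exposes F G t adj f on = edge-faces F G f adj (trans (sym (onFace-edgeSlot F G t f)) on)

levelCoord-injective : ∀ {N} κ κ' (t t' : Fin N) → levelCoord κ t ≡ levelCoord κ' t' →
  κ ≡ κ' × (κ ≡ mid → t ≡ t')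
levelCoord-injective low  low  t t' _ = refl , λ ()
levelCoord-injective high high t t' _ = refl , λ ()
levelCoord-injective mid  mid  t t' e = refl , λ _ → FinP.inject₁-injective (FinP.suc-injective e)
levelCoord-injective high mid  t t' e = ⊥-elim (FinP.fromℕ≢inject₁ (FinP.suc-injective e))
levelCoord-injective mid  high t t' e = ⊥-elim (FinP.fromℕ≢inject₁ (sym (FinP.suc-injective e)))
levelCoord-injective low  high t t' ()
levelCoord-injective low  mid  t t' ()
levelCoord-injective high low  t t' ()
levelCoord-injective mid  low  t t' ()

edgeSlot-injective : ∀ {N} F G F' G' (t t' : Fin N) → Adjacent F G → Adjacent F' G' →
  edgeSlot F G t ≡ edgeSlot F' G' t' → ((F ≡ F' × G ≡ G') ⊎ (F ≡ G' × G ≡ F')) × t ≡ t'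
edgeSlot-injective F G F' G' t t' adj adj' same =
  edgeLevel-injective F G F' G' adj adj' (λ ax → proj₁ (levels ax)) , sameSlot
  where
  levels : ∀ ax → edgeLevel F G ax ≡ edgeLevel F' G' ax × (edgeLevel F G ax ≡ mid → t ≡ t')
  levels ax = levelCoord-injective _ _ t t'
    (trans (sym (coord-edgeSlot F G t ax)) (trans (cong (coord ax) same) (coord-edgeSlot F' G' t' ax)))
  sameSlot : t ≡ t'
  sameSlot with ax , isMid ← edge-direction F G adj = proj₂ (levels ax) isMid

count : {A : Set} → (A → Bool) → List A → ℕ
count Q xs = sum (map (λ x → if Q x then 1 else 0) xs)

count-++ : {A : Set} (Q : A → Bool) (xs ys : List A) →
  count Q (xs ++ ys) ≡ count Q xs + count Q ys
count-++ Q xs ys = trans (cong sum (ListP.map-++ indicator xs ys)) (sum-++ (map indicator xs) _)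
  where
  indicator : _ → ℕ
  indicator x = if Q x then 1 else 0

count-cartesian : {A B : Set} (Q : A × B → Bool) (xs : List A) (ys : List B) →
  count Q (cartesianProduct xs ys)
    ≡ sum (map (λ a → sum (map (λ b → if Q (a , b) then 1 else 0) ys)) xs)
count-cartesian Q []       ys = refl
count-cartesian Q (x ∷ xs) ys = begin
  count Q (map (x ,_) ys ++ cartesianProduct xs ys)
    ≡⟨ count-++ Q (map (x ,_) ys) (cartesianProduct xs ys) ⟩
  count Q (map (x ,_) ys) + count Q (cartesianProduct xs ys)
    ≡⟨ cong₂ _+_ (cong sum (sym (ListP.map-∘ ys))) (count-cartesian Q xs ys) ⟩
  sum (map (λ b → if Q (x , b) then 1 else 0) ys)
    + sum (map (λ a → sum (map (λ b → if Q (a , b) then 1 else 0) ys)) xs) ∎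
  where open ≡-Reasoning

record Selection {A : Set} (Q : A → Bool) (xs : List A) (k : ℕ) : Set where
  field
    item      : Fin k → A
    passes    : ∀ j → T (Q (item j))
    member    : ∀ j → item j ∈ xs
    injective : ∀ i j → item i ≡ item j → i ≡ j

selection : {A : Set} (Q : A → Bool) (xs : List A) → Unique xs → Selection Q xs (count Q xs)
selection Q [] _ = record { item = λ () ; passes = λ () ; member = λ () ; injective = λ () }
selection Q (x ∷ xs) (x∉xs ∷ unique) with Q x in passesx
... | false = record { item = item ; passes = passes ; member = there ∘ member ; injective = injective }
  where open Selection (selection Q xs unique)
... | true  = record { item = item′ ; passes = passes′ ; member = member′ ; injective = injective′ }
  where
  open Selection (selection Q xs unique)
  item′ : Fin (suc (count Q xs)) → _
  item′ f0     = x
  item′ (fs j) = item j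
  passes′ : ∀ j → T (Q (item′ j))
  passes′ f0     = subst T (sym passesx) tt
  passes′ (fs j) = passes j
  member′ : ∀ j → item′ j ∈ x ∷ xs
  member′ f0     = here refl
  member′ (fs j) = there (member j)
  injective′ : ∀ i j → item′ i ≡ item′ j → i ≡ j
  injective′ f0     f0     _ = refl
  injective′ f0     (fs j) e = ⊥-elim (All.lookup x∉xs (member j) e)
  injective′ (fs i) f0     e = ⊥-elim (All.lookup x∉xs (member i) (sym e))
  injective′ (fs i) (fs j) e = cong fs (injective i j e)

Distinct : {E : Set} {k : ℕ} → (Fin k → E) → Set
Distinct option = ∀ i j → option i ≡ option j → i ≡ j

avoiding-option : {E : Set} {m k : ℕ} → DecidableEquality E → m < k →
  (option : Fin k → E) → Distinct option → (forbidden : Fin m → E) →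
  ∃ λ j → ∀ r → ¬ option j ≡ forbidden r
avoiding-option _≟_ m<k option distinct forbidden
  with FinP.any? (λ j → FinP.all? λ r → ¬? (option j ≟ forbidden r))
... | yes avoiding = avoiding
... | no noneAvoids = ⊥-elim impossible
  where
  -- every option hits some forbidden value, so two options hit the same one
  hit : ∀ j → ∃ λ r → option j ≡ forbidden r
  hit j with FinP.any? (λ r → option j ≟ forbidden r)
  ... | yes h    = h
  ... | no  miss = ⊥-elim (noneAvoids (j , λ r e → miss (r , e)))
  impossible : ⊥
  impossible with i , j , i<j , sameHit ← FinP.pigeonhole m<k (proj₁ ∘ hit) =
    FinP.<-irrefl (distinct i j
      (trans (proj₂ (hit i)) (trans (cong forbidden sameHit) (sym (proj₂ (hit j)))))) i<j

distinct-representatives : {E : Set} → DecidableEquality E → (m k : ℕ) → m ≤ k →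
  (option : Fin m → Fin k → E) → (∀ r → Distinct (option r)) →
  Σ (Fin m → Fin k) λ choice → ∀ r r' → option r (choice r) ≡ option r' (choice r') → r ≡ r'
distinct-representatives _≟_ zero k _ _ _ = (λ ()) , λ ()
distinct-representatives _≟_ (suc m) k m<k option distinct
  with choice′ , distinct′ ← distinct-representatives _≟_ m k (ℕP.<⇒≤ m<k)
                               (option ∘ fs) (distinct ∘ fs)
  with j₀ , avoids ← avoiding-option _≟_ m<k (option f0) (distinct f0)
                       (λ r → option (fs r) (choice′ r))
  = choice , distinctChoice
  where
  choice : Fin (suc m) → Fin k
  choice f0     = j₀
  choice (fs r) = choice′ r
  distinctChoice : ∀ r r' → option r (choice r) ≡ option r' (choice r') → r ≡ r'
  distinctChoice f0     f0      _ = refl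
  distinctChoice f0     (fs r') e = ⊥-elim (avoids r' e)
  distinctChoice (fs r) f0      e = ⊥-elim (avoids r (sym e))
  distinctChoice (fs r) (fs r') e = cong fs (distinct′ r r' e)

-- Index i of Fin (k * N) is row r of layer t, where remQuot i = (r , t).
layer : (k N : ℕ) → Fin (k * N) → Fin N
layer k N i = proj₂ (remQuot {k} N i)

layered-representatives : {E : Set} → DecidableEquality E → (k N : ℕ) →
  (option : Fin (k * N) → Fin k → E) → (∀ i → Distinct (option i)) →
  Σ (Fin (k * N) → Fin k) λ choice →
    ∀ i j → layer k N i ≡ layer k N j → option i (choice i) ≡ option j (choice j) → i ≡ j
layered-representatives {E} _≟_ k N option distinct = choice , distinctChoice
  where
  inLayer : (t : Fin N) → Σ (Fin k → Fin k) λ choice → ∀ r r' →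
    option (combine r t) (choice r) ≡ option (combine r' t) (choice r') → r ≡ r'
  inLayer t = distinct-representatives _≟_ k k ℕP.≤-refl
                (λ r → option (combine r t)) (λ r → distinct (combine r t))
  chosen : Fin k × Fin N → E
  chosen (r , t) = option (combine r t) (proj₁ (inLayer t) r)
  chosen-distinct : ∀ p p' → proj₂ p ≡ proj₂ p' → chosen p ≡ chosen p' → proj₁ p ≡ proj₁ p'
  chosen-distinct (r , t) (r' , .t) refl = proj₂ (inLayer t) r r'
  combine-remQuot : ∀ i → uncurry combine (remQuot {k} N i) ≡ i
  combine-remQuot = FinP.combine-remQuot {k} N
  choice : Fin (k * N) → Fin k
  choice i = proj₁ (inLayer (layer k N i)) (proj₁ (remQuot {k} N i))
  option-chosen : ∀ i → option i (choice i) ≡ chosen (remQuot {k} N i)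
  option-chosen i = cong (λ x → option x (choice i)) (sym (combine-remQuot i))
  distinctChoice : ∀ i j → layer k N i ≡ layer k N j → option i (choice i) ≡ option j (choice j) → i ≡ j
  distinctChoice i j sameLayer same = begin
    i                                   ≡⟨ combine-remQuot i ⟨
    uncurry combine (remQuot {k} N i)   ≡⟨ cong (uncurry combine) (cong₂ _,_ sameRow sameLayer) ⟩
    uncurry combine (remQuot {k} N j)   ≡⟨ combine-remQuot j ⟩
    j                                   ∎
    where
    open ≡-Reasoning
    sameRow : proj₁ (remQuot {k} N i) ≡ proj₁ (remQuot {k} N j)
    sameRow = chosen-distinct _ _ sameLayer
      (trans (sym (option-chosen i)) (trans same (option-chosen j)))

sharedB : Cube → Cube → Color × Color → Bool
sharedB c v (a , b) = (toℕ a <ᵇ toℕ b) ∧ adjPairB c a b ∧ adjPairB v a b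

colorPairs : List (Color × Color)
colorPairs = cartesianProduct (allFin 6) (allFin 6)

sharedPairs-count : ∀ c v → sharedPairs c v ≡ count (sharedB c v) colorPairs
sharedPairs-count c v = sym (count-cartesian (sharedB c v) (allFin 6) (allFin 6))

sharedPair-selection : ∀ c v {k} → sharedPairs c v ≡ k → Selection (sharedB c v) colorPairs k
sharedPair-selection c v shares =
  subst (Selection (sharedB c v) colorPairs) (trans (sym (sharedPairs-count c v)) shares)
    (selection (sharedB c v) colorPairs
      (UniqueP.cartesianProduct⁺ (UniqueP.allFin⁺ 6) (UniqueP.allFin⁺ 6)))

record SharedPair (c v : Cube) (a b : Color) : Set where
  field
    ordered : toℕ a < toℕ b
    inCube  : AdjacentFaces c a b
    inModel : AdjacentFaces v a b

sharedPair-of : ∀ c v (p : Color × Color) → T (sharedB c v p) → SharedPair c v (proj₁ p) (proj₂ p)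
sharedPair-of c v (a , b) passes
  with lt , adjacent ← Equivalence.to (BoolP.T-∧ {toℕ a <ᵇ toℕ b}) passes
  with inC , inV     ← Equivalence.to (BoolP.T-∧ {adjPairB c a b}) adjacent
  = record { ordered = ℕP.<ᵇ⇒< (toℕ a) (toℕ b) lt
           ; inCube  = adjacentFaces-of c a b inC
           ; inModel = adjacentFaces-of v a b inV }

pairSlot : ∀ {N w a b} → AdjacentFaces w a b → Fin N → Pos (suc (suc N))
pairSlot W = edgeSlot (AdjacentFaces.faceA W) (AdjacentFaces.faceB W)

-- For ordered pairs (a < b), a slot determines the pair and the slot number:
-- equal slots lie on the same edge, whose faces carry the same colors, and
-- reading the edge with its faces swapped would give a < b < a.
pairSlot-injective : ∀ {N w a b a' b'} (W : AdjacentFaces w a b) (W' : AdjacentFaces w a' b')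
  (t t' : Fin N) → toℕ a < toℕ b → toℕ a' < toℕ b' →
  pairSlot W t ≡ pairSlot W' t' → (a , b) ≡ (a' , b') × t ≡ t'
pairSlot-injective (adjacentFaces F G adj wa wb) (adjacentFaces F' G' adj' wa' wb') t t' a<b a'<b' same
  with edgeSlot-injective F G F' G' t t' adj adj' same
... | inj₁ (refl , refl) , sameSlot = cong₂ _,_ (trans (sym wa) wa') (trans (sym wb) wb') , sameSlot
... | inj₂ (refl , refl) , sameSlot =
  ⊥-elim (ℕP.<-asym a'<b' (subst₂ (λ x y → toℕ x < toℕ y) (trans (sym wa) wb') (trans (sym wb) wa') a<b))

module Placement {w v : Cube} (w~v : SameVariety w v) where
  open AdjacentFaces using (faceA; faceB; adjacent)

  modelFaces : ∀ {c a b} → SharedPair c v a b → AdjacentFaces w a b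
  modelFaces S = transport-adjacentFaces w~v (SharedPair.inModel S)

  slot : ∀ {N c a b} → SharedPair c v a b → Fin N → Pos (suc (suc N))
  slot S = pairSlot (modelFaces S)

  rotation : ∀ {c a b} → SharedPair c v a b → Rot
  rotation S = proj₁ (alignment (modelFaces S) (SharedPair.inCube S))

  slot-isEdge : ∀ {N c a b} (S : SharedPair c v a b) (t : Fin N) → IsEdgeNonCorner (slot S t)
  slot-isEdge S t = edgeSlot-isEdge (faceA (modelFaces S)) (faceB (modelFaces S)) t
    (adjacent (modelFaces S))

  slot-fits : ∀ {N c a b} (S : SharedPair c v a b) (t : Fin N) → Fits w (slot S t) c (rotation S)
  slot-fits S t = alignment-fits (modelFaces S) (SharedPair.inCube S) (slot S t)
    (edgeSlot-exposes (faceA (modelFaces S)) (faceB (modelFaces S)) t (adjacent (modelFaces S)))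

  slot-injective : ∀ {N c c' a b a' b'} (S : SharedPair c v a b) (S' : SharedPair c' v a' b')
    (t t' : Fin N) → slot S t ≡ slot S' t' → (a , b) ≡ (a' , b') × t ≡ t'
  slot-injective S S' t t' = pairSlot-injective (modelFaces S) (modelFaces S') t t'
    (SharedPair.ordered S) (SharedPair.ordered S')

lemma5p1 : (n k : ℕ) → 2 ≤ n → (v w : Cube) → SameVariety w v →
    CornerSolution n w →
    (cubes : Fin (k * (n ∸ 2)) → Cube) →
    (∀ i → sharedPairs (cubes i) v ≡ k) →
    Σ (Fin (k * (n ∸ 2)) → Pos n) λ pos → Σ (Fin (k * (n ∸ 2)) → Rot) λ ρ →
      (∀ i j → pos i ≡ pos j → i ≡ j)
      × (∀ i → IsEdgeNonCorner (pos i))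
      × (∀ i → Fits w (pos i) (cubes i) (ρ i))
lemma5p1 (suc (suc N)) k (s≤s (s≤s z≤n)) v w w~v _ cubes shares =
  position , rotation ∘ S , position-injective , position-isEdge , position-fits
  where
  open Placement {w} {v} w~v
  pairs : ∀ i → Selection (sharedB (cubes i) v) colorPairs k
  pairs i = sharedPair-selection (cubes i) v (shares i)
  representatives : Σ (Fin (k * N) → Fin k) λ choice → ∀ i j → layer k N i ≡ layer k N j →
    Selection.item (pairs i) (choice i) ≡ Selection.item (pairs j) (choice j) → i ≡ j
  representatives = layered-representatives (ProdP.≡-dec FinP._≟_ FinP._≟_) k N
    (Selection.item ∘ pairs) (Selection.injective ∘ pairs)
  pair : Fin (k * N) → Color × Color
  pair i = Selection.item (pairs i) (proj₁ representatives i)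
  S : ∀ i → SharedPair (cubes i) v (proj₁ (pair i)) (proj₂ (pair i))
  S i = sharedPair-of (cubes i) v (pair i) (Selection.passes (pairs i) (proj₁ representatives i))
  position : Fin (k * N) → Pos (suc (suc N))
  position i = slot (S i) (layer k N i)
  position-injective : ∀ i j → position i ≡ position j → i ≡ j
  position-injective i j same =
    let samePair , sameLayer = slot-injective (S i) (S j) (layer k N i) (layer k N j) same
    in proj₂ representatives i j sameLayer samePair
  position-isEdge : ∀ i → IsEdgeNonCorner (position i)
  position-isEdge i = slot-isEdge (S i) (layer k N i)
  position-fits : ∀ i → Fits w (position i) (cubes i) (rotation (S i))
  position-fits i = slot-fits (S i) (layer k N i)
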